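{- Let $k\ge 2$ and let $H$ be a $k$-uniform hypergraph on $n$ vertices. There is an ordering $v_1,v_2,\ldots,v_n$ of $V(H)$ such that for each $i\in[n]$, the number of sets $S\subseteq\{v_1,\ldots,v_{i-1}\}$ for which there exists an edge $e$ of $H$ with $e\cap\{v_1,\ldots,v_i\}=S\cup\{v_i\}$ is at most $k^2 d_{\mathsf{max}}(H)$.
   Context: For $0\le i<k$, the $i$-skeleton $H^{(i)}$ of a $k$-uniform hypergraph $H$ is the $(i+1)$-uniform hypergraph on $V(H)$ whose edges are all $(i+1)$-sets contained in some edge of $H$; $d_i(H)$ is the degeneracy of $H^{(i)}$, i.e. the least $d$ such that every subhypergraph of $H^{(i)}$ has minimum degree at most $d$. The max-skeletal degeneracy is $d_{\mathsf{max}}(H)=\max_{1\le i<k} d_i(H)$. -}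

module Defs where

open import Data.Nat using (ℕ; zero; suc; _≤_; _<_; _≡ᵇ_; _<ᵇ_)
open import Data.Bool using (Bool; true; false; _∧_; if_then_else_)
import Data.Bool.Properties as BoolP
open import Data.List using (List; []; _∷_; [_]; map; _++_)
open import Data.Bool.ListAction using (any)
open import Data.Fin using (Fin; toℕ)
open import Data.Fin.Subset using (Subset; inside; outside; ∣_∣; _∈_; _⊆_; _∩_; _∪_; ⁅_⁆; Nonempty)
open import Data.Fin.Subset.Properties using (_⊆?_; _∈?_)
open import Data.Fin.Permutation using (Permutation′; _⟨$⟩ʳ_; _⟨$⟩ˡ_)
open import Data.Vec using (Vec; []; _∷_; tabulate)
open import Data.Vec.Properties using (≡-dec)
open import Data.Product using (Σ; ∃; _×_)
open import Relation.Nullary.Decidable using (⌊_⌋)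
open import Relation.Binary.PropositionalEquality using (_≡_)

allSubsets : (n : ℕ) → List (Subset n)
allSubsets zero = [ [] ]
allSubsets (suc n) = map (inside ∷_) (allSubsets n) ++ map (outside ∷_) (allSubsets n)

countᵇ : {A : Set} → (A → Bool) → List A → ℕ
countᵇ p [] = 0
countᵇ p (x ∷ xs) = if p x then suc (countᵇ p xs) else countᵇ p xs

-- A hypergraph on vertex set Fin n, given by the characteristic function
-- of its edge set (a set of subsets of Fin n).
Hypergraph : ℕ → Set
Hypergraph n = Subset n → Bool

IsUniform : {n : ℕ} → ℕ → Hypergraph n → Set
IsUniform {n} k H = ∀ (e : Subset n) → H e ≡ true → ∣ e ∣ ≡ k

skeleton : {n : ℕ} → ℕ → Hypergraph n → Hypergraph n
skeleton {n} i H e = (∣ e ∣ ≡ᵇ suc i) ∧ any (λ f → H f ∧ ⌊ e ⊆? f ⌋) (allSubsets n)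

degree : {n : ℕ} → Hypergraph n → Fin n → ℕ
degree {n} F v = countᵇ (λ e → F e ∧ ⌊ v ∈? e ⌋) (allSubsets n)

IsSubhypergraph : {n : ℕ} → Subset n → Hypergraph n → Hypergraph n → Set
IsSubhypergraph {n} W F G = ∀ (e : Subset n) → F e ≡ true → (G e ≡ true) × (e ⊆ W)

Degenerate : {n : ℕ} → ℕ → Hypergraph n → Set
Degenerate {n} d G = ∀ (W : Subset n) (F : Hypergraph n) → Nonempty W →
  IsSubhypergraph W F G → ∃ λ (v : Fin n) → (v ∈ W) × (degree F v ≤ d)

IsDegeneracy : {n : ℕ} → Hypergraph n → ℕ → Set
IsDegeneracy G d = Degenerate d G × (∀ (d' : ℕ) → Degenerate d' G → d ≤ d')

IsMaxSkeletalDegeneracy : {n : ℕ} → ℕ → Hypergraph n → ℕ → Set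
IsMaxSkeletalDegeneracy k H D =
  (∀ (i : ℕ) → 1 ≤ i → i < k → ∃ λ d → IsDegeneracy (skeleton i H) d × (d ≤ D)) ×
  (∃ λ i → (1 ≤ i) × (i < k) × IsDegeneracy (skeleton i H) D)

-- For the ordering v_j = π j (0-indexed positions), the set of vertices
-- at positions < m.
prefixSet : {n : ℕ} → Permutation′ n → ℕ → Subset n
prefixSet π m = tabulate (λ u → toℕ (π ⟨$⟩ˡ u) <ᵇ m)

_≟ˢ_ : {n : ℕ} → (a b : Subset n) → Bool
a ≟ˢ b = ⌊ ≡-dec BoolP._≟_ a b ⌋

backCount : {n : ℕ} → Hypergraph n → Permutation′ n → Fin n → ℕ
backCount {n} H π i =
  countᵇ (λ S → ⌊ S ⊆? prefixSet π (toℕ i) ⌋ ∧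
                any (λ e → H e ∧ ((e ∩ prefixSet π (suc (toℕ i))) ≟ˢ (S ∪ ⁅ π ⟨$⟩ʳ i ⁆)))
                    (allSubsets n))
         (allSubsets n)

{-# OPTIONS --safe #-}
-- Order the vertices from the back.  If W is the set of vertices still to be placed and v ∈ W is
-- put last among them, every set S counted for v gives the trace X = S ∪ {v} = e ∩ W of an edge e.
-- Either X = {v}, or X ⊆ W has 2 ≤ |X| ≤ k and lies in an edge, i.e. X is an edge through v of some
-- i-skeleton (1 ≤ i < k) restricted to W; call these X the shadow of H in W.  A D-degenerate
-- hypergraph has at most D|W| edges inside W, so the shadow has at most (k-1)D|W| members; each has
-- at most k vertices, so their degrees sum to at most k(k-1)D|W| and some v ∈ W lies in at most
-- k(k-1)D of them.  Placing that v last gives a count of at most 1 + k(k-1)D ≤ k²D, since D ≥ 1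
-- as soon as H has an edge.

module Submission where

open import Data.Bool using (Bool; true; false; _∧_; not)
open import Data.Bool.ListAction using (any)
open import Data.Bool.Properties using (∨-identityʳ; ∨-zeroʳ; T-≡) renaming (_≟_ to _≟ᴮ_)
open import Data.Empty using (⊥-elim)
open import Data.Fin using (Fin; zero; suc; toℕ; fromℕ<; opposite)
open import Data.Fin.Permutation using (Permutation′; _⟨$⟩ʳ_; _⟨$⟩ˡ_; permutation; _∘ₚ_)
import Data.Fin.Permutation as Perm
open import Data.Fin.Properties
  using (any?; toℕ-fromℕ<; toℕ<n; toℕ-injective; opposite-prop) renaming (_≟_ to _≟ᶠ_)
open import Data.Fin.Subset
  using (Subset; inside; outside; _∈_; _∉_; _⊆_; _∩_; _∪_; _─_; _-_; ⁅_⁆; ∣_∣; ⊤; ⊥; Nonempty)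
open import Data.Fin.Subset.Properties
  using ( _∈?_; _⊆?_; nonempty?; ⊆-refl; ⊆-antisym; ∈⊤; ∣⊤∣≡n; ∣⊥∣≡0; x∈⁅x⁆; x∈⁅y⁆⇒x≡y; ∣⁅x⁆∣≡1
        ; p⊆q⇒∣p∣≤∣q∣; p∩q⊆p; p∩q⊆q; ∪-identityʳ; p─q⊆p; p─⊥≡p; x∈p∧x≢y⇒x∈p-y; drop-there; Empty-unique)
open import Data.List using (List; []; _∷_; map; _++_; length; allFin)
open import Data.List.Membership.Propositional using () renaming (_∈_ to _∈ᴸ_)
open import Data.List.Membership.Propositional.Properties using (∈-++⁺ˡ; ∈-++⁺ʳ; ∈-map⁺; ∈-allFin)
open import Data.List.Properties using (map-++; map-∘; length-tabulate; map-tabulate)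
open import Data.List.Relation.Unary.Any using () renaming (here to hereᴸ; there to thereᴸ)
open import Data.Nat
  using (ℕ; zero; suc; _+_; _*_; _∸_; _≤_; _<_; _≤′_; ≤′-refl; ≤′-step; _≤?_; z≤n; s≤s; s≤s⁻¹; z<s)
open import Data.Nat.ListAction using (sum)
open import Data.Nat.ListAction.Properties using (sum-++)
open import Data.Nat.Properties
open import Algebra.Properties.CommutativeSemigroup +-commutativeSemigroup using (interchange)
open import Data.Nat.Solver using (module +-*-Solver)
open import Data.Product using (Σ; ∃; _×_; _,_; proj₁; proj₂)
open import Data.Sum using (_⊎_; inj₁; inj₂)
open import Data.Vec using ([]; _∷_; updateAt; here; there)
open import Data.Vec.Properties using (≡-dec; lookup∘tabulate; lookup⇒[]=; []=⇒lookup)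
open import Function using (_∘_; id)
open import Function.Bundles using (Equivalence)
open import Relation.Binary.PropositionalEquality
open import Relation.Nullary using (Dec; yes; no; ¬_; _×-dec_)
open import Relation.Nullary.Decidable using (⌊_⌋; isYes≗does; ⌊⌋-map′)

open import Defs

-- Booleans and sums
⟦_⟧ : Bool → ℕ
⟦ true ⟧ = 1
⟦ false ⟧ = 0

⟦⟧-mono : ∀ {a b} → (a ≡ true → b ≡ true) → ⟦ a ⟧ ≤ ⟦ b ⟧
⟦⟧-mono {false} _ = z≤n
⟦⟧-mono {true} a⇒b rewrite a⇒b refl = ≤-refl

⟦⟧-⊎ : ∀ {a b c} → (a ≡ true → b ≡ true ⊎ c ≡ true) → ⟦ a ⟧ ≤ ⟦ b ⟧ + ⟦ c ⟧
⟦⟧-⊎ {false} _ = z≤n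
⟦⟧-⊎ {true} {b} a⇒b⊎c with a⇒b⊎c refl
... | inj₁ refl = s≤s z≤n
... | inj₂ refl = m≤n+m 1 ⟦ b ⟧

⟦⟧-split : ∀ a b → ⟦ a ⟧ ≡ ⟦ a ∧ not b ⟧ + ⟦ a ∧ b ⟧
⟦⟧-split false _ = refl
⟦⟧-split true false = refl
⟦⟧-split true true = refl

∧-true⁻ : ∀ {a b} → a ∧ b ≡ true → a ≡ true × b ≡ true
∧-true⁻ {true} {true} _ = refl , refl

∧-true⁺ : ∀ {a b} → a ≡ true → b ≡ true → a ∧ b ≡ true
∧-true⁺ refl refl = refl

⌊⌋-true⁻ : ∀ {P : Set} (P? : Dec P) → ⌊ P? ⌋ ≡ true → P
⌊⌋-true⁻ (yes p) _ = p

not⌊⌋-true⁻ : ∀ {P : Set} (P? : Dec P) → not ⌊ P? ⌋ ≡ true → ¬ P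
not⌊⌋-true⁻ (no ¬p) _ = ¬p

⌊⌋-true⁺ : ∀ {P : Set} (P? : Dec P) → P → ⌊ P? ⌋ ≡ true
⌊⌋-true⁺ (yes _) _ = refl
⌊⌋-true⁺ (no ¬p) p = ⊥-elim (¬p p)

∑ : {A : Set} → List A → (A → ℕ) → ℕ
∑ xs f = sum (map f xs)

syntax ∑ xs (λ x → e) = ∑[ x ← xs ] e

private variable A B : Set

countᵇ≡∑ : (p : A → Bool) (xs : List A) → countᵇ p xs ≡ ∑[ x ← xs ] ⟦ p x ⟧
countᵇ≡∑ p [] = refl
countᵇ≡∑ p (x ∷ xs) with p x
... | true = cong suc (countᵇ≡∑ p xs)
... | false = countᵇ≡∑ p xs

∑-cong : ∀ {f g : A → ℕ} xs → (∀ x → f x ≡ g x) → ∑ xs f ≡ ∑ xs g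
∑-cong [] f≗g = refl
∑-cong (x ∷ xs) f≗g = cong₂ _+_ (f≗g x) (∑-cong xs f≗g)

∑-mono : ∀ {f g : A → ℕ} xs → (∀ x → f x ≤ g x) → ∑ xs f ≤ ∑ xs g
∑-mono [] f≤g = z≤n
∑-mono (x ∷ xs) f≤g = +-mono-≤ (f≤g x) (∑-mono xs f≤g)

∑-const : ∀ (xs : List A) c → ∑[ x ← xs ] c ≡ length xs * c
∑-const [] c = refl
∑-const (x ∷ xs) c = cong (c +_) (∑-const xs c)

∑-zero : ∀ (xs : List A) → ∑[ x ← xs ] 0 ≡ 0
∑-zero xs = trans (∑-const xs 0) (*-zeroʳ (length xs))

*-distribʳ-∑ : ∀ c (f : A → ℕ) xs → ∑ xs f * c ≡ ∑[ x ← xs ] (f x * c)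
*-distribʳ-∑ c f [] = refl
*-distribʳ-∑ c f (x ∷ xs) = trans (*-distribʳ-+ c (f x) (∑ xs f)) (cong (f x * c +_) (*-distribʳ-∑ c f xs))

∑-distrib-+ : ∀ (f g : A → ℕ) xs → ∑[ x ← xs ] (f x + g x) ≡ ∑ xs f + ∑ xs g
∑-distrib-+ f g [] = refl
∑-distrib-+ f g (x ∷ xs) =
  trans (cong (f x + g x +_) (∑-distrib-+ f g xs)) (interchange (f x) (g x) (∑ xs f) (∑ xs g))

∑-∈ : ∀ (f : A → ℕ) {x xs} → x ∈ᴸ xs → f x ≤ ∑ xs f
∑-∈ f (hereᴸ refl) = m≤m+n (f _) _
∑-∈ f {xs = y ∷ xs} (thereᴸ x∈xs) = ≤-trans (∑-∈ f x∈xs) (m≤n+m _ (f y))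

any-true⁺ : ∀ (p : A → Bool) {x xs} → x ∈ᴸ xs → p x ≡ true → any p xs ≡ true
any-true⁺ p (hereᴸ refl) px rewrite px = refl
any-true⁺ p {xs = y ∷ xs} (thereᴸ x∈xs) px rewrite any-true⁺ p x∈xs px = ∨-zeroʳ (p y)

any-true⁻ : ∀ (p : A → Bool) xs → any p xs ≡ true → ∃ λ x → p x ≡ true
any-true⁻ p (x ∷ xs) any≡true with p x in px
... | true = x , px
... | false = any-true⁻ p xs any≡true

countᵇ-pos⁻ : ∀ (p : A → Bool) xs → 0 < countᵇ p xs → ∃ λ x → p x ≡ true
countᵇ-pos⁻ p (x ∷ xs) pos with p x in px
... | true = x , px
... | false = countᵇ-pos⁻ p xs pos

countᵇ-∈ : ∀ (p : A → Bool) {x xs} → x ∈ᴸ xs → p x ≡ true → 1 ≤ countᵇ p xs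
countᵇ-∈ p {x} {xs} x∈xs px = begin
  1                   ≡⟨ cong ⟦_⟧ px ⟨
  ⟦ p x ⟧             ≤⟨ ∑-∈ (λ y → ⟦ p y ⟧) x∈xs ⟩
  ∑[ y ← xs ] ⟦ p y ⟧ ≡⟨ countᵇ≡∑ p xs ⟨
  countᵇ p xs         ∎
  where open ≤-Reasoning

∑-++ : ∀ (f : A → ℕ) xs ys → ∑ (xs ++ ys) f ≡ ∑ xs f + ∑ ys f
∑-++ f xs ys = trans (cong sum (map-++ f xs ys)) (sum-++ (map f xs) (map f ys))

∑-map : ∀ (f : B → ℕ) (g : A → B) xs → ∑ (map g xs) f ≡ ∑ xs (f ∘ g)
∑-map f g xs = cong sum (sym (map-∘ {g = f} {f = g} xs))

∑-comm : ∀ (f : A → B → ℕ) xs (ys : List B) →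
         ∑[ x ← xs ] ∑[ y ← ys ] f x y ≡ ∑[ y ← ys ] ∑[ x ← xs ] f x y
∑-comm f [] ys = sym (∑-zero ys)
∑-comm f (x ∷ xs) ys = begin
  ∑ ys (f x) + ∑[ x′ ← xs ] ∑[ y ← ys ] f x′ y ≡⟨ cong (∑ ys (f x) +_) (∑-comm f xs ys) ⟩
  ∑ ys (f x) + ∑[ y ← ys ] ∑[ x′ ← xs ] f x′ y ≡⟨ ∑-distrib-+ (f x) _ ys ⟨
  ∑[ y ← ys ] (f x y + ∑[ x′ ← xs ] f x′ y)    ∎
  where open ≡-Reasoning

-- Subsets of Fin n
∈-allSubsets : ∀ {n} (S : Subset n) → S ∈ᴸ allSubsets n
∈-allSubsets [] = hereᴸ refl
∈-allSubsets {suc n} (inside ∷ S) = ∈-++⁺ˡ (∈-map⁺ (inside ∷_) (∈-allSubsets S))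
∈-allSubsets {suc n} (outside ∷ S) =
  ∈-++⁺ʳ (map (inside ∷_) (allSubsets n)) (∈-map⁺ (outside ∷_) (∈-allSubsets S))

∑-allSubsets-suc : ∀ n (f : Subset (suc n) → ℕ) →
  ∑ (allSubsets (suc n)) f ≡ ∑[ S ← allSubsets n ] f (inside ∷ S) + ∑[ S ← allSubsets n ] f (outside ∷ S)
∑-allSubsets-suc n f = trans (∑-++ f (map (inside ∷_) (allSubsets n)) _)
  (cong₂ _+_ (∑-map f (inside ∷_) (allSubsets n)) (∑-map f (outside ∷_) (allSubsets n)))

-- Not definitional: ⌊_⌋ does not reduce through the map′ inside ≡-dec.
∷-≟ˢ-∷ : ∀ {n} a b (S T : Subset n) → ((a ∷ S) ≟ˢ (b ∷ T)) ≡ ⌊ a ≟ᴮ b ⌋ ∧ (S ≟ˢ T)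
∷-≟ˢ-∷ a b S T = trans (isYes≗does _)
  (sym (cong₂ _∧_ (isYes≗does (a ≟ᴮ b)) (isYes≗does (≡-dec _≟ᴮ_ S T))))

∑-≟ˢ : ∀ {n} (T : Subset n) → ∑[ S ← allSubsets n ] ⟦ S ≟ˢ T ⟧ ≡ 1
∑-≟ˢ [] = refl
∑-≟ˢ {suc n} (b ∷ T) = begin
  ∑ (allSubsets (suc n)) (λ S → ⟦ S ≟ˢ (b ∷ T) ⟧)
    ≡⟨ ∑-allSubsets-suc n _ ⟩
  ∑[ S ← allSubsets n ] ⟦ (inside ∷ S) ≟ˢ (b ∷ T) ⟧ + ∑[ S ← allSubsets n ] ⟦ (outside ∷ S) ≟ˢ (b ∷ T) ⟧
    ≡⟨ cong₂ _+_ (∑-cong (allSubsets n) (λ S → cong ⟦_⟧ (∷-≟ˢ-∷ inside b S T)))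
                 (∑-cong (allSubsets n) (λ S → cong ⟦_⟧ (∷-≟ˢ-∷ outside b S T))) ⟩
  ∑[ S ← allSubsets n ] ⟦ ⌊ inside ≟ᴮ b ⌋ ∧ (S ≟ˢ T) ⟧ + ∑[ S ← allSubsets n ] ⟦ ⌊ outside ≟ᴮ b ⌋ ∧ (S ≟ˢ T) ⟧
    ≡⟨ one-summand b ⟩
  1 ∎
  where
  open ≡-Reasoning
  one-summand : ∀ b → ∑[ S ← allSubsets n ] ⟦ ⌊ inside ≟ᴮ b ⌋ ∧ (S ≟ˢ T) ⟧
                    + ∑[ S ← allSubsets n ] ⟦ ⌊ outside ≟ᴮ b ⌋ ∧ (S ≟ˢ T) ⟧ ≡ 1
  one-summand inside = cong₂ _+_ (∑-≟ˢ T) (∑-zero (allSubsets n))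
  one-summand outside = cong₂ _+_ (∑-zero (allSubsets n)) (∑-≟ˢ T)

toggle : ∀ {n} → Fin n → Subset n → Subset n
toggle v S = updateAt S v not

∑-toggle : ∀ n (v : Fin n) (f : Subset n → ℕ) →
  ∑ (allSubsets n) f ≡ ∑[ S ← allSubsets n ] f (toggle v S)
∑-toggle (suc n) zero f = begin
  ∑ (allSubsets (suc n)) f ≡⟨ ∑-allSubsets-suc n f ⟩
  ∑[ S ← allSubsets n ] f (inside ∷ S) + ∑[ S ← allSubsets n ] f (outside ∷ S)
    ≡⟨ +-comm (∑[ S ← allSubsets n ] f (inside ∷ S)) _ ⟩
  ∑[ S ← allSubsets n ] f (outside ∷ S) + ∑[ S ← allSubsets n ] f (inside ∷ S)
    ≡⟨ ∑-allSubsets-suc n (f ∘ toggle zero) ⟨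
  ∑[ S ← allSubsets (suc n) ] f (toggle zero S) ∎
  where open ≡-Reasoning
∑-toggle (suc n) (suc v) f = begin
  ∑ (allSubsets (suc n)) f ≡⟨ ∑-allSubsets-suc n f ⟩
  ∑[ S ← allSubsets n ] f (inside ∷ S) + ∑[ S ← allSubsets n ] f (outside ∷ S)
    ≡⟨ cong₂ _+_ (∑-toggle n v (f ∘ (inside ∷_))) (∑-toggle n v (f ∘ (outside ∷_))) ⟩
  ∑[ S ← allSubsets n ] f (inside ∷ toggle v S) + ∑[ S ← allSubsets n ] f (outside ∷ toggle v S)
    ≡⟨ ∑-allSubsets-suc n (f ∘ toggle (suc v)) ⟨
  ∑[ S ← allSubsets (suc n) ] f (toggle (suc v) S) ∎
  where open ≡-Reasoning

∉-toggle⇒∈ : ∀ {n} (v : Fin n) (S : Subset n) → v ∉ toggle v S → v ∈ S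
∉-toggle⇒∈ zero (inside ∷ S) _ = here
∉-toggle⇒∈ zero (outside ∷ S) v∉ = ⊥-elim (v∉ here)
∉-toggle⇒∈ (suc v) (b ∷ S) v∉ = there (∉-toggle⇒∈ v S (v∉ ∘ there))

toggle-∪-⁅⁆ : ∀ {n} (v : Fin n) (S : Subset n) → v ∈ S → toggle v S ∪ ⁅ v ⁆ ≡ S
toggle-∪-⁅⁆ zero (inside ∷ S) here = cong (inside ∷_) (∪-identityʳ S)
toggle-∪-⁅⁆ (suc v) (b ∷ S) (there v∈S) = cong₂ _∷_ (∨-identityʳ b) (toggle-∪-⁅⁆ v S v∈S)

∑-allFin-suc : ∀ n (f : Fin (suc n) → ℕ) → ∑ (allFin (suc n)) f ≡ f zero + ∑[ v ← allFin n ] f (suc v)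
∑-allFin-suc n f = cong (f zero +_) (cong sum (trans (map-tabulate suc f) (sym (map-tabulate id (f ∘ suc)))))

∑-suc∈?∷ : ∀ {n} s (T : Subset n) →
  ∑[ v ← allFin n ] ⟦ ⌊ suc v ∈? (s ∷ T) ⌋ ⟧ ≡ ∑[ v ← allFin n ] ⟦ ⌊ v ∈? T ⌋ ⟧
∑-suc∈?∷ {n} s T = ∑-cong (allFin n) (λ v → cong ⟦_⟧ (⌊⌋-map′ there drop-there (v ∈? T)))

∑-∈?≡∣∣ : ∀ {n} (T : Subset n) → ∑[ v ← allFin n ] ⟦ ⌊ v ∈? T ⌋ ⟧ ≡ ∣ T ∣
∑-∈?≡∣∣ [] = refl
∑-∈?≡∣∣ {suc n} (inside ∷ T) = trans (∑-allFin-suc n (λ v → ⟦ ⌊ v ∈? (inside ∷ T) ⌋ ⟧))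
  (cong suc (trans (∑-suc∈?∷ inside T) (∑-∈?≡∣∣ T)))
∑-∈?≡∣∣ {suc n} (outside ∷ T) = trans (∑-allFin-suc n (λ v → ⟦ ⌊ v ∈? (outside ∷ T) ⌋ ⟧))
  (trans (∑-suc∈?∷ outside T) (∑-∈?≡∣∣ T))

nonempty⇒0<∣p∣ : ∀ {n} {p : Subset n} → Nonempty p → 0 < ∣ p ∣
nonempty⇒0<∣p∣ {p = p} (x , x∈p) = begin
  1         ≡⟨ ∣⁅x⁆∣≡1 x ⟨
  ∣ ⁅ x ⁆ ∣ ≤⟨ p⊆q⇒∣p∣≤∣q∣ (λ y∈⁅x⁆ → subst (_∈ p) (sym (x∈⁅y⁆⇒x≡y x y∈⁅x⁆)) x∈p) ⟩
  ∣ p ∣     ∎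
  where open ≤-Reasoning

∣p∣≡0⇒p≡⊥ : ∀ {n} {p : Subset n} → ∣ p ∣ ≡ 0 → p ≡ ⊥
∣p∣≡0⇒p≡⊥ ∣p∣≡0 = Empty-unique (λ ne → <⇒≢ (nonempty⇒0<∣p∣ ne) (sym ∣p∣≡0))

0<∣p∣⇒nonempty : ∀ {n} {p : Subset n} → 0 < ∣ p ∣ → Nonempty p
0<∣p∣⇒nonempty {n} {p} 0<∣p∣ with nonempty? p
... | yes ne = ne
... | no ¬ne = ⊥-elim (<⇒≢ 0<∣p∣ (sym (trans (cong ∣_∣ (Empty-unique ¬ne)) (∣⊥∣≡0 n))))

x∈p⇒suc∣p-x∣≡∣p∣ : ∀ {n} {p : Subset n} {x} → x ∈ p → suc ∣ p - x ∣ ≡ ∣ p ∣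
x∈p⇒suc∣p-x∣≡∣p∣ {p = inside ∷ p} here = cong (suc ∘ ∣_∣) (p─⊥≡p p)
x∈p⇒suc∣p-x∣≡∣p∣ {p = inside ∷ p} (there x∈p) = cong suc (x∈p⇒suc∣p-x∣≡∣p∣ x∈p)
x∈p⇒suc∣p-x∣≡∣p∣ {p = outside ∷ p} (there x∈p) = x∈p⇒suc∣p-x∣≡∣p∣ x∈p

x∈p─q⇒x∉q : ∀ {n} {x : Fin n} (p q : Subset n) → x ∈ p ─ q → x ∉ q
x∈p─q⇒x∉q (_ ∷ p) (inside ∷ q) () here
x∈p─q⇒x∉q (_ ∷ p) (_ ∷ q) (there x∈p─q) (there x∈q) = x∈p─q⇒x∉q p q x∈p─q x∈q

x∈p∧∣p∣≤1⇒p≡⁅x⁆ : ∀ {n} {p : Subset n} {x} → x ∈ p → ∣ p ∣ ≤ 1 → p ≡ ⁅ x ⁆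
x∈p∧∣p∣≤1⇒p≡⁅x⁆ {p = inside ∷ p} here (s≤s ∣p∣≤0) = cong (inside ∷_) (∣p∣≡0⇒p≡⊥ (n≤0⇒n≡0 ∣p∣≤0))
x∈p∧∣p∣≤1⇒p≡⁅x⁆ {p = inside ∷ p} (there x∈p) (s≤s ∣p∣≤0) =
  ⊥-elim (<⇒≱ (nonempty⇒0<∣p∣ (_ , x∈p)) ∣p∣≤0)
x∈p∧∣p∣≤1⇒p≡⁅x⁆ {p = outside ∷ p} (there x∈p) ∣p∣≤1 = cong (outside ∷_) (x∈p∧∣p∣≤1⇒p≡⁅x⁆ x∈p ∣p∣≤1)

-- Degenerate hypergraphs
edgeCount : ∀ {n} → Hypergraph n → ℕ
edgeCount {n} F = countᵇ F (allSubsets n)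

_-ᴴ_ : ∀ {n} → Hypergraph n → Fin n → Hypergraph n
(F -ᴴ v) e = F e ∧ not ⌊ v ∈? e ⌋

edgeCount-split : ∀ {n} (F : Hypergraph n) v → edgeCount F ≡ edgeCount (F -ᴴ v) + degree F v
edgeCount-split {n} F v = begin
  countᵇ F ALL
    ≡⟨ countᵇ≡∑ F ALL ⟩
  ∑[ e ← ALL ] ⟦ F e ⟧
    ≡⟨ ∑-cong ALL (λ e → ⟦⟧-split (F e) _) ⟩
  ∑[ e ← ALL ] (⟦ (F -ᴴ v) e ⟧ + ⟦ F e ∧ ⌊ v ∈? e ⌋ ⟧)
    ≡⟨ ∑-distrib-+ _ _ ALL ⟩
  ∑[ e ← ALL ] ⟦ (F -ᴴ v) e ⟧ + ∑[ e ← ALL ] ⟦ F e ∧ ⌊ v ∈? e ⌋ ⟧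
    ≡⟨ cong₂ _+_ (countᵇ≡∑ _ ALL) (countᵇ≡∑ _ ALL) ⟨
  edgeCount (F -ᴴ v) + degree F v
    ∎
  where
  open ≡-Reasoning
  ALL = allSubsets n

-ᴴ-subhypergraph : ∀ {n} {W : Subset n} {F G} v → IsSubhypergraph W F G → IsSubhypergraph (W - v) (F -ᴴ v) G
-ᴴ-subhypergraph v sub e Fe∧v∉e with ∧-true⁻ Fe∧v∉e
... | Fe , v∉e = proj₁ (sub e Fe) , λ x∈e →
  x∈p∧x≢y⇒x∈p-y (proj₂ (sub e Fe) x∈e) (λ { refl → not⌊⌋-true⁻ (v ∈? e) v∉e x∈e })

Degenerate-mono : ∀ {n d d′} {G : Hypergraph n} → d ≤ d′ → Degenerate d G → Degenerate d′ G
Degenerate-mono d≤d′ deg W F ne sub with deg W F ne sub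
... | v , v∈W , degv≤d = v , v∈W , ≤-trans degv≤d d≤d′

degenerate⇒edgeCount≤d*∣W∣ : ∀ {n d} {G F : Hypergraph n} {W : Subset n} → Degenerate d G →
  IsSubhypergraph W F G → (∀ e → F e ≡ true → Nonempty e) → edgeCount F ≤ d * ∣ W ∣
degenerate⇒edgeCount≤d*∣W∣ {n} {d} {G} deg = go _ refl
  where
  go : ∀ m {W F} → ∣ W ∣ ≡ m → IsSubhypergraph W F G → (∀ e → F e ≡ true → Nonempty e) →
       edgeCount F ≤ d * ∣ W ∣
  go zero {W} {F} ∣W∣≡0 sub nonempty = ≤-trans (≮⇒≥ noEdge) z≤n
    where
    noEdge : ¬ 0 < edgeCount F
    noEdge pos with countᵇ-pos⁻ F (allSubsets n) pos
    ... | e , Fe with nonempty e Fe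
    ...   | x , x∈e = <⇒≢ (nonempty⇒0<∣p∣ (x , proj₂ (sub e Fe) x∈e)) (sym ∣W∣≡0)
  go (suc m) {W} {F} ∣W∣≡1+m sub nonempty
    with deg W F (0<∣p∣⇒nonempty (subst (0 <_) (sym ∣W∣≡1+m) z<s)) sub
  ... | v , v∈W , degv≤d = begin
    edgeCount F                     ≡⟨ edgeCount-split F v ⟩
    edgeCount (F -ᴴ v) + degree F v ≤⟨ +-mono-≤ (go m ∣W-v∣≡m (-ᴴ-subhypergraph v sub) nonempty-v) degv≤d ⟩
    d * ∣ W - v ∣ + d               ≡⟨ +-comm _ d ⟩
    d + d * ∣ W - v ∣               ≡⟨ *-suc d _ ⟨
    d * suc ∣ W - v ∣               ≡⟨ cong (d *_) (x∈p⇒suc∣p-x∣≡∣p∣ v∈W) ⟩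
    d * ∣ W ∣                       ∎
    where
    open ≤-Reasoning
    ∣W-v∣≡m : ∣ W - v ∣ ≡ m
    ∣W-v∣≡m = suc-injective (trans (x∈p⇒suc∣p-x∣≡∣p∣ v∈W) ∣W∣≡1+m)
    nonempty-v : ∀ e → (F -ᴴ v) e ≡ true → Nonempty e
    nonempty-v e = nonempty e ∘ proj₁ ∘ ∧-true⁻

degenerate⇒1≤d : ∀ {n d} {G : Hypergraph n} {e} → Degenerate d G → G e ≡ true → Nonempty e → 1 ≤ d
degenerate⇒1≤d {G = G} {e} deg Ge ne with deg e (_≟ˢ e) ne single
  where
  single : IsSubhypergraph e (_≟ˢ e) G
  single f f≟e with ⌊⌋-true⁻ (≡-dec _≟ᴮ_ f e) f≟e
  ... | refl = Ge , ⊆-refl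
... | v , v∈e , degv≤d = ≤-trans (countᵇ-∈ _ (∈-allSubsets e) v∈e∈F) degv≤d
  where
  v∈e∈F : ((e ≟ˢ e) ∧ ⌊ v ∈? e ⌋) ≡ true
  v∈e∈F = ∧-true⁺ (⌊⌋-true⁺ (≡-dec _≟ᴮ_ e e) refl) (⌊⌋-true⁺ (v ∈? e) v∈e)

handshake : ∀ {n} (F : Hypergraph n) c → (∀ e → F e ≡ true → ∣ e ∣ ≤ c) →
  ∑[ v ← allFin n ] degree F v ≤ edgeCount F * c
handshake {n} F c small = begin
  ∑[ v ← allFin n ] degree F v                         ≡⟨ ∑-cong (allFin n) (λ v → countᵇ≡∑ _ ALL) ⟩
  ∑[ v ← allFin n ] ∑[ e ← ALL ] ⟦ F e ∧ ⌊ v ∈? e ⌋ ⟧ ≡⟨ ∑-comm (λ v e → ⟦ F e ∧ ⌊ v ∈? e ⌋ ⟧) (allFin n) ALL ⟩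
  ∑[ e ← ALL ] ∑[ v ← allFin n ] ⟦ F e ∧ ⌊ v ∈? e ⌋ ⟧ ≤⟨ ∑-mono ALL edge ⟩
  ∑[ e ← ALL ] (⟦ F e ⟧ * c)                           ≡⟨ *-distribʳ-∑ c (λ e → ⟦ F e ⟧) ALL ⟨
  ∑[ e ← ALL ] ⟦ F e ⟧ * c                             ≡⟨ cong (_* c) (countᵇ≡∑ F ALL) ⟨
  edgeCount F * c                                      ∎
  where
  open ≤-Reasoning
  ALL = allSubsets n
  edge : ∀ e → ∑[ v ← allFin n ] ⟦ F e ∧ ⌊ v ∈? e ⌋ ⟧ ≤ ⟦ F e ⟧ * c
  edge e with F e in Fe
  ... | false = ≤-reflexive (∑-zero (allFin n))
  ... | true = ≤-trans (≤-reflexive (∑-∈?≡∣∣ e)) (≤-trans (small e Fe) (≤-reflexive (sym (+-identityʳ c))))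

averaging : ∀ {n} (W : Subset n) (g : Fin n → ℕ) C → Nonempty W →
  ∑[ v ← allFin n ] g v ≤ ∣ W ∣ * C → ∃ λ v → v ∈ W × g v ≤ C
averaging {n} W g C ne total with any? (λ v → (v ∈? W) ×-dec (g v ≤? C))
... | yes found = found
... | no none = ⊥-elim (<⇒≱ (begin-strict
  ∣ W ∣ * C                                 <⟨ +-monoˡ-< (∣ W ∣ * C) (nonempty⇒0<∣p∣ ne) ⟩
  ∣ W ∣ + ∣ W ∣ * C                         ≡⟨ *-suc ∣ W ∣ C ⟨
  ∣ W ∣ * suc C                             ≡⟨ cong (_* suc C) (∑-∈?≡∣∣ W) ⟨
  ∑[ v ← allFin n ] ⟦ ⌊ v ∈? W ⌋ ⟧ * suc C   ≡⟨ *-distribʳ-∑ (suc C) _ (allFin n) ⟩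
  ∑[ v ← allFin n ] (⟦ ⌊ v ∈? W ⌋ ⟧ * suc C) ≤⟨ ∑-mono (allFin n) large ⟩
  ∑[ v ← allFin n ] g v                     ∎) total)
  where
  open ≤-Reasoning
  large : ∀ v → ⟦ ⌊ v ∈? W ⌋ ⟧ * suc C ≤ g v
  large v with v ∈? W
  ... | no _ = z≤n
  ... | yes v∈W = subst (_≤ g v) (sym (+-identityʳ (suc C))) (≰⇒> (λ gv≤C → none (v , v∈W , gv≤C)))

_↾_ : ∀ {n} → Hypergraph n → Subset n → Hypergraph n
(G ↾ W) X = G X ∧ ⌊ X ⊆? W ⌋

↾-subhypergraph : ∀ {n} (G : Hypergraph n) W → IsSubhypergraph W (G ↾ W) G
↾-subhypergraph G W X GX∧X⊆W with ∧-true⁻ GX∧X⊆W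
... | GX , X⊆W = GX , ⌊⌋-true⁻ (X ⊆? W) X⊆W

-- Shadows and traces
covered : ∀ {n} → Hypergraph n → Subset n → Bool
covered {n} H X = any (λ e → H e ∧ ⌊ X ⊆? e ⌋) (allSubsets n)

covered⁺ : ∀ {n} (H : Hypergraph n) {X e} → H e ≡ true → X ⊆ e → covered H X ≡ true
covered⁺ H {X} {e} He X⊆e =
  any-true⁺ (λ f → H f ∧ ⌊ X ⊆? f ⌋) (∈-allSubsets e) (∧-true⁺ He (⌊⌋-true⁺ (X ⊆? e) X⊆e))

covered⇒∣∣≤ : ∀ {n k} {H : Hypergraph n} → IsUniform k H → ∀ X → covered H X ≡ true → ∣ X ∣ ≤ k
covered⇒∣∣≤ {n} uniform X cov with any-true⁻ _ (allSubsets n) cov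
... | e , He∧X⊆e with ∧-true⁻ He∧X⊆e
...   | He , X⊆e = ≤-trans (p⊆q⇒∣p∣≤∣q∣ (⌊⌋-true⁻ (X ⊆? e) X⊆e)) (≤-reflexive (uniform e He))

skeleton-nonempty : ∀ {n} i (H : Hypergraph n) e → skeleton i H e ≡ true → Nonempty e
skeleton-nonempty i H e ske = 0<∣p∣⇒nonempty (subst (0 <_) (sym ∣e∣≡1+i) z<s)
  where
  ∣e∣≡1+i : ∣ e ∣ ≡ suc i
  ∣e∣≡1+i = ≡ᵇ⇒≡ _ _ (Equivalence.from T-≡ (proj₁ (∧-true⁻ ske)))

shadow : ∀ {n} → Hypergraph n → Subset n → Hypergraph n
shadow H W X = ⌊ X ⊆? W ⌋ ∧ ⌊ 2 ≤? ∣ X ∣ ⌋ ∧ covered H X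

shadow⁺ : ∀ {n} (H : Hypergraph n) {W X} → X ⊆ W → 2 ≤ ∣ X ∣ → covered H X ≡ true → shadow H W X ≡ true
shadow⁺ H {W} {X} X⊆W 2≤∣X∣ cov = ∧-true⁺ (⌊⌋-true⁺ (X ⊆? W) X⊆W) (∧-true⁺ (⌊⌋-true⁺ (2 ≤? ∣ X ∣) 2≤∣X∣) cov)

shadow⇒∣∣≤ : ∀ {n k} {H : Hypergraph n} → IsUniform k H → ∀ W X → shadow H W X ≡ true → ∣ X ∣ ≤ k
shadow⇒∣∣≤ uniform W X sh =
  covered⇒∣∣≤ uniform X (proj₂ (∧-true⁻ {⌊ 2 ≤? ∣ X ∣ ⌋} (proj₂ (∧-true⁻ {⌊ X ⊆? W ⌋} sh))))

2≤m≤1+r⇒m≡2+j : ∀ r m → 2 ≤ m → m ≤ suc r → ∃ λ (j : Fin r) → m ≡ suc (suc (toℕ j))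
2≤m≤1+r⇒m≡2+j r (suc (suc m)) (s≤s (s≤s z≤n)) (s≤s m<r) = fromℕ< m<r , cong (2 +_) (sym (toℕ-fromℕ< m<r))

⟦shadow⟧≤∑skeleta : ∀ {n} r {H : Hypergraph n} → IsUniform (suc r) H → ∀ W X →
  ⟦ shadow H W X ⟧ ≤ ∑[ j ← allFin r ] ⟦ (skeleton (suc (toℕ j)) H ↾ W) X ⟧
⟦shadow⟧≤∑skeleta r {H} uniform W X with shadow H W X in sh
... | false = z≤n
... | true with ∧-true⁻ sh
...   | X⊆W , 2≤∣X∣∧cov with ∧-true⁻ 2≤∣X∣∧cov
...     | 2≤∣X∣ , cov with 2≤m≤1+r⇒m≡2+j r ∣ X ∣ (⌊⌋-true⁻ (2 ≤? ∣ X ∣) 2≤∣X∣) (covered⇒∣∣≤ uniform X cov)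
...       | j , ∣X∣≡2+j =
  ≤-trans (≤-reflexive (cong ⟦_⟧ (sym X∈level))) (∑-∈ (λ j → ⟦ (skeleton (suc (toℕ j)) H ↾ W) X ⟧) (∈-allFin j))
  where
  X∈level : (skeleton (suc (toℕ j)) H ↾ W) X ≡ true
  X∈level = ∧-true⁺ (∧-true⁺ (Equivalence.to T-≡ (≡⇒≡ᵇ _ _ ∣X∣≡2+j)) cov) X⊆W

isTrace : ∀ {n} → Hypergraph n → Subset n → Subset n → Bool
isTrace {n} H W X = any (λ e → H e ∧ ((e ∩ W) ≟ˢ X)) (allSubsets n)

-- backCount H π i unfolds to traceCount H (prefixSet π (toℕ i)) (prefixSet π (suc (toℕ i))) (π ⟨$⟩ʳ i).
traceCount : ∀ {n} → Hypergraph n → Subset n → Subset n → Fin n → ℕ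
traceCount {n} H U W v = countᵇ (λ S → ⌊ S ⊆? U ⌋ ∧ isTrace H W (S ∪ ⁅ v ⁆)) (allSubsets n)

traceCount-mono : ∀ {n} (H : Hypergraph n) {U U′} W v → U ⊆ U′ → traceCount H U W v ≤ traceCount H U′ W v
traceCount-mono {n} H {U} {U′} W v U⊆U′ = begin
  traceCount H U W v                                        ≡⟨ countᵇ≡∑ _ ALL ⟩
  ∑[ S ← ALL ] ⟦ ⌊ S ⊆? U ⌋ ∧ isTrace H W (S ∪ ⁅ v ⁆) ⟧   ≤⟨ ∑-mono ALL (λ S → ⟦⟧-mono (widen S)) ⟩
  ∑[ S ← ALL ] ⟦ ⌊ S ⊆? U′ ⌋ ∧ isTrace H W (S ∪ ⁅ v ⁆) ⟧  ≡⟨ countᵇ≡∑ _ ALL ⟨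
  traceCount H U′ W v                                       ∎
  where
  open ≤-Reasoning
  ALL = allSubsets n
  widen : ∀ S → (⌊ S ⊆? U ⌋ ∧ isTrace H W (S ∪ ⁅ v ⁆)) ≡ true → (⌊ S ⊆? U′ ⌋ ∧ isTrace H W (S ∪ ⁅ v ⁆)) ≡ true
  widen S S⊆U∧tr with ∧-true⁻ {⌊ S ⊆? U ⌋} S⊆U∧tr
  ... | S⊆U , tr = ∧-true⁺ (⌊⌋-true⁺ (S ⊆? U′) (U⊆U′ ∘ ⌊⌋-true⁻ (S ⊆? U) S⊆U)) tr

traceCount-pos⇒edge : ∀ {n} (H : Hypergraph n) U W v → 0 < traceCount H U W v → ∃ λ e → H e ≡ true
traceCount-pos⇒edge {n} H U W v pos with countᵇ-pos⁻ _ (allSubsets n) pos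
... | S , S⊆U∧tr with any-true⁻ _ (allSubsets n) (proj₂ (∧-true⁻ {⌊ S ⊆? U ⌋} S⊆U∧tr))
...   | e , He∧trace = e , proj₁ (∧-true⁻ He∧trace)

toggled-trace : ∀ {n} (H : Hypergraph n) W v X →
  (⌊ toggle v X ⊆? W - v ⌋ ∧ isTrace H W (toggle v X ∪ ⁅ v ⁆)) ≡ true →
  (X ≟ˢ ⁅ v ⁆) ≡ true ⊎ (shadow H W X ∧ ⌊ v ∈? X ⌋) ≡ true
toggled-trace {n} H W v X S⊆W-v∧tr with ∧-true⁻ {⌊ toggle v X ⊆? W - v ⌋} S⊆W-v∧tr
... | S⊆W-v , tr with any-true⁻ _ (allSubsets n) tr
...   | e , He∧trace with ∧-true⁻ {H e} He∧trace
...     | He , trace = split (≤-<-connex 2 ∣ X ∣)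
  where
  v∈X : v ∈ X
  v∈X = ∉-toggle⇒∈ v X (λ v∈S → x∈p─q⇒x∉q W ⁅ v ⁆ (⌊⌋-true⁻ (_ ⊆? _) S⊆W-v v∈S) (x∈⁅x⁆ v))
  e∩W≡X : e ∩ W ≡ X
  e∩W≡X = trans (⌊⌋-true⁻ (≡-dec _≟ᴮ_ (e ∩ W) _) trace) (toggle-∪-⁅⁆ v X v∈X)
  X⊆W : X ⊆ W
  X⊆W x∈X = p∩q⊆q e W (subst (_ ∈_) (sym e∩W≡X) x∈X)
  X⊆e : X ⊆ e
  X⊆e x∈X = p∩q⊆p e W (subst (_ ∈_) (sym e∩W≡X) x∈X)
  split : 2 ≤ ∣ X ∣ ⊎ ∣ X ∣ < 2 → (X ≟ˢ ⁅ v ⁆) ≡ true ⊎ (shadow H W X ∧ ⌊ v ∈? X ⌋) ≡ true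
  split (inj₁ 2≤∣X∣) = inj₂ (∧-true⁺ (shadow⁺ H X⊆W 2≤∣X∣ (covered⁺ H He X⊆e)) (⌊⌋-true⁺ (v ∈? X) v∈X))
  split (inj₂ ∣X∣<2) = inj₁ (⌊⌋-true⁺ (≡-dec _≟ᴮ_ X ⁅ v ⁆) (x∈p∧∣p∣≤1⇒p≡⁅x⁆ v∈X (s≤s⁻¹ ∣X∣<2)))

-- Toggling v matches each S ⊆ W - v with X = S ∪ ⁅ v ⁆; such an X is ⁅ v ⁆ or a shadow set through v.
traceCount≤1+degree : ∀ {n} (H : Hypergraph n) W v → traceCount H (W - v) W v ≤ 1 + degree (shadow H W) v
traceCount≤1+degree {n} H W v = begin
  traceCount H (W - v) W v                ≡⟨ countᵇ≡∑ _ ALL ⟩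
  ∑[ S ← ALL ] ⟦ trace S ⟧                ≡⟨ ∑-toggle n v _ ⟩
  ∑[ X ← ALL ] ⟦ trace (toggle v X) ⟧
    ≤⟨ ∑-mono ALL (λ X → ⟦⟧-⊎ (toggled-trace H W v X)) ⟩
  ∑[ X ← ALL ] (⟦ X ≟ˢ ⁅ v ⁆ ⟧ + ⟦ shadow H W X ∧ ⌊ v ∈? X ⌋ ⟧)
    ≡⟨ ∑-distrib-+ _ _ ALL ⟩
  ∑[ X ← ALL ] ⟦ X ≟ˢ ⁅ v ⁆ ⟧ + ∑[ X ← ALL ] ⟦ shadow H W X ∧ ⌊ v ∈? X ⌋ ⟧
    ≡⟨ cong₂ _+_ (∑-≟ˢ ⁅ v ⁆) (sym (countᵇ≡∑ _ ALL)) ⟩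
  1 + degree (shadow H W) v ∎
  where
  open ≤-Reasoning
  ALL = allSubsets n
  trace : Subset n → Bool
  trace S = ⌊ S ⊆? W - v ⌋ ∧ isTrace H W (S ∪ ⁅ v ⁆)

maxSkeletalDegeneracy⇒degenerate : ∀ {n k} {H : Hypergraph n} {D} → IsMaxSkeletalDegeneracy k H D →
  ∀ i → 1 ≤ i → i < k → Degenerate D (skeleton i H)
maxSkeletalDegeneracy⇒degenerate (skeleta , _) i 1≤i i<k with skeleta i 1≤i i<k
... | d , (d-degenerate , _) , d≤D = Degenerate-mono d≤D d-degenerate

-- r stands for k - 1: the skeleta in play are the i-skeleta with 1 ≤ i ≤ r.
module _ {n : ℕ} (r : ℕ) {H : Hypergraph n} (uniform : IsUniform (suc r) H) {D : ℕ}
         (degenerate : ∀ i → 1 ≤ i → i < suc r → Degenerate D (skeleton i H)) where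

  edgeCount-shadow : ∀ W → edgeCount (shadow H W) ≤ r * (D * ∣ W ∣)
  edgeCount-shadow W = begin
    edgeCount (shadow H W)                          ≡⟨ countᵇ≡∑ _ ALL ⟩
    ∑[ X ← ALL ] ⟦ shadow H W X ⟧                   ≤⟨ ∑-mono ALL (⟦shadow⟧≤∑skeleta r uniform W) ⟩
    ∑[ X ← ALL ] ∑[ j ← allFin r ] ⟦ level j X ⟧    ≡⟨ ∑-comm (λ X j → ⟦ level j X ⟧) ALL (allFin r) ⟩
    ∑[ j ← allFin r ] ∑[ X ← ALL ] ⟦ level j X ⟧    ≤⟨ ∑-mono (allFin r) edgeCount-level ⟩
    ∑[ j ← allFin r ] (D * ∣ W ∣)                   ≡⟨ ∑-const (allFin r) _ ⟩
    length (allFin r) * (D * ∣ W ∣)                 ≡⟨ cong (_* (D * ∣ W ∣)) (length-tabulate {n = r} id) ⟩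
    r * (D * ∣ W ∣)                                 ∎
    where
    open ≤-Reasoning
    ALL = allSubsets n
    level : Fin r → Hypergraph n
    level j = skeleton (suc (toℕ j)) H ↾ W
    edgeCount-level : ∀ j → ∑[ X ← ALL ] ⟦ level j X ⟧ ≤ D * ∣ W ∣
    edgeCount-level j = subst (_≤ D * ∣ W ∣) (countᵇ≡∑ (level j) ALL)
      (degenerate⇒edgeCount≤d*∣W∣ (degenerate (suc (toℕ j)) (s≤s z≤n) (s≤s (toℕ<n j))) (↾-subhypergraph _ W)
        (λ X → skeleton-nonempty _ H X ∘ proj₁ ∘ ∧-true⁻))

  lowShadowDegreeVertex : ∀ W → Nonempty W → ∃ λ v → v ∈ W × degree (shadow H W) v ≤ suc r * r * D
  lowShadowDegreeVertex W ne = averaging W (degree (shadow H W)) (suc r * r * D) ne (begin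
    ∑[ v ← allFin n ] degree (shadow H W) v ≤⟨ handshake (shadow H W) (suc r) (shadow⇒∣∣≤ uniform W) ⟩
    edgeCount (shadow H W) * suc r          ≤⟨ *-monoˡ-≤ (suc r) (edgeCount-shadow W) ⟩
    r * (D * ∣ W ∣) * suc r                 ≡⟨ rearrange r D ∣ W ∣ ⟩
    ∣ W ∣ * (suc r * r * D)                 ∎)
    where
    open ≤-Reasoning
    rearrange : ∀ r D w → r * (D * w) * suc r ≡ w * (suc r * r * D)
    rearrange = solve 3 (λ r D w → r :* (D :* w) :* (con 1 :+ r) := w :* ((con 1 :+ r) :* r :* D)) refl
      where open +-*-Solver

  edge⇒1≤D : 1 ≤ r → ∀ e → H e ≡ true → 1 ≤ D
  edge⇒1≤D 1≤r e He = degenerate⇒1≤d (degenerate r 1≤r ≤-refl) e∈skeleton (skeleton-nonempty r H e e∈skeleton)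
    where
    e∈skeleton : skeleton r H e ≡ true
    e∈skeleton = ∧-true⁺ (Equivalence.to T-≡ (≡⇒≡ᵇ _ _ (uniform e He))) (covered⁺ H He ⊆-refl)

  lowTraceCountVertex : 1 ≤ r → ∀ W → Nonempty W → ∃ λ v → v ∈ W × traceCount H (W - v) W v ≤ suc r * suc r * D
  lowTraceCountVertex 1≤r W ne with lowShadowDegreeVertex W ne
  ... | v , v∈W , deg≤ = v , v∈W , nonzero-suffices bound
    where
    nonzero-suffices : ∀ {m b} → (0 < m → m ≤ b) → m ≤ b
    nonzero-suffices {zero} _ = z≤n
    nonzero-suffices {suc m} h = h z<s
    bound : 0 < traceCount H (W - v) W v → traceCount H (W - v) W v ≤ suc r * suc r * D
    bound pos with traceCount-pos⇒edge H (W - v) W v pos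
    ... | e , He = begin
      traceCount H (W - v) W v    ≤⟨ traceCount≤1+degree H W v ⟩
      1 + degree (shadow H W) v   ≤⟨ +-mono-≤ (*-mono-≤ {1} {suc r} (s≤s z≤n) (edge⇒1≤D 1≤r e He)) deg≤ ⟩
      suc r * D + suc r * r * D   ≡⟨ rearrange r D ⟩
      suc r * suc r * D           ∎
      where
      open ≤-Reasoning
      rearrange : ∀ r D → suc r * D + suc r * r * D ≡ suc r * suc r * D
      rearrange = solve 2 (λ r D → (con 1 :+ r) :* D :+ (con 1 :+ r) :* r :* D
                                  := (con 1 :+ r) :* (con 1 :+ r) :* D) refl
        where open +-*-Solver

-- Greedy orderings
crossing : ∀ {Q : ℕ → Set} → (∀ j → Dec (Q j)) → ∀ m → Q 0 → ¬ Q m → ∃ λ j → j < m × Q j × ¬ Q (suc j)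
crossing Q? zero q₀ ¬q₀ = ⊥-elim (¬q₀ q₀)
crossing Q? (suc m) q₀ ¬q₁₊ₘ with Q? m
... | yes qₘ = m , ≤-refl , qₘ , ¬q₁₊ₘ
... | no ¬qₘ with crossing Q? m q₀ ¬qₘ
...   | j , j<m , qⱼ , ¬q₁₊ⱼ = j , m<n⇒m<1+n j<m , qⱼ , ¬q₁₊ⱼ

∸-suc<⇒∸≤ : ∀ {n t m} → t < n → n ∸ suc t < m → n ∸ m ≤ t
∸-suc<⇒∸≤ {n} {t} {m} t<n lt = m≤n+o⇒m∸n≤o n m (begin
  n                   ≡⟨ m∸n+n≡m t<n ⟨
  n ∸ suc t + suc t   ≡⟨ +-suc (n ∸ suc t) t ⟩
  suc (n ∸ suc t) + t ≤⟨ +-monoˡ-≤ t lt ⟩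
  m + t               ∎)
  where open ≤-Reasoning

∸≤⇒∸-suc< : ∀ {n t m} → t < n → n ∸ m ≤ t → n ∸ suc t < m
∸≤⇒∸-suc< {n} {t} {m} t<n le = +-cancelʳ-≤ t (suc (n ∸ suc t)) m (begin
  suc (n ∸ suc t) + t ≡⟨ +-suc (n ∸ suc t) t ⟨
  n ∸ suc t + suc t   ≡⟨ m∸n+n≡m t<n ⟩
  n                   ≤⟨ m≤n+m∸n n m ⟩
  m + (n ∸ m)         ≤⟨ +-monoʳ-≤ m le ⟩
  m + t               ∎)
  where open ≤-Reasoning

∈-prefixSet⁺ : ∀ {n} (π : Permutation′ n) {m u} → toℕ (π ⟨$⟩ˡ u) < m → u ∈ prefixSet π m
∈-prefixSet⁺ π {m} {u} lt = lookup⇒[]= u _ (trans (lookup∘tabulate _ u) (Equivalence.to T-≡ (<⇒<ᵇ lt)))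

∈-prefixSet⁻ : ∀ {n} (π : Permutation′ n) {m u} → u ∈ prefixSet π m → toℕ (π ⟨$⟩ˡ u) < m
∈-prefixSet⁻ π {m} {u} u∈ = <ᵇ⇒< _ m (Equivalence.from T-≡ (trans (sym (lookup∘tabulate _ u)) ([]=⇒lookup u∈)))

prefixSet-step : ∀ {n} (π : Permutation′ n) i → prefixSet π (toℕ i) ⊆ prefixSet π (suc (toℕ i)) - (π ⟨$⟩ʳ i)
prefixSet-step π i {u} u∈ = x∈p∧x≢y⇒x∈p-y (∈-prefixSet⁺ π (m<n⇒m<1+n (∈-prefixSet⁻ π u∈))) u≢πi
  where
  u≢πi : u ≢ π ⟨$⟩ʳ i
  u≢πi refl = <-irrefl (cong toℕ (Perm.inverseˡ π)) (∈-prefixSet⁻ π u∈)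

-- The ordering is built from the back: the j-th removed vertex gets position n ∸ suc j.
module GreedyOrdering {n : ℕ} (P : Subset n → Fin n → Set)
  (choose : ∀ W → Nonempty W → ∃ λ v → v ∈ W × P W v) (default : Fin n) where

  pick : Subset n → Fin n
  pick W with nonempty? W
  ... | yes ne = proj₁ (choose W ne)
  ... | no _ = default

  pick-spec : ∀ W → Nonempty W → pick W ∈ W × P W (pick W)
  pick-spec W ne with nonempty? W
  ... | yes ne′ = proj₂ (choose W ne′)
  ... | no ¬ne = ⊥-elim (¬ne ne)

  remaining : ℕ → Subset n
  remaining zero = ⊤
  remaining (suc j) = remaining j - pick (remaining j)

  ∣remaining∣+j≡n : ∀ j → j ≤ n → ∣ remaining j ∣ + j ≡ n
  remaining-nonempty : ∀ j → j < n → Nonempty (remaining j)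

  ∣remaining∣+j≡n zero _ = trans (+-identityʳ _) (∣⊤∣≡n n)
  ∣remaining∣+j≡n (suc j) j<n = begin
    ∣ remaining (suc j) ∣ + suc j ≡⟨ +-suc _ j ⟩
    suc ∣ remaining (suc j) ∣ + j ≡⟨ cong (_+ j) (x∈p⇒suc∣p-x∣≡∣p∣ (proj₁ (pick-spec _ (remaining-nonempty j j<n)))) ⟩
    ∣ remaining j ∣ + j           ≡⟨ ∣remaining∣+j≡n j (<⇒≤ j<n) ⟩
    n                             ∎
    where open ≡-Reasoning

  remaining-nonempty j j<n = 0<∣p∣⇒nonempty (positive _ (∣remaining∣+j≡n j (<⇒≤ j<n)))
    where
    positive : ∀ s → s + j ≡ n → 0 < s
    positive zero j≡n = ⊥-elim (<-irrefl j≡n j<n)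
    positive (suc s) _ = z<s

  pick∈ : ∀ j → j < n → pick (remaining j) ∈ remaining j
  pick∈ j j<n = proj₁ (pick-spec _ (remaining-nonempty j j<n))

  ∉-remaining-n : ∀ u → u ∉ remaining n
  ∉-remaining-n u u∈ = <⇒≢ (nonempty⇒0<∣p∣ (u , u∈)) (sym (+-cancelʳ-≡ n _ 0 (∣remaining∣+j≡n n ≤-refl)))

  remaining-antitone : ∀ {j j′} → j ≤′ j′ → remaining j′ ⊆ remaining j
  remaining-antitone ≤′-refl = id
  remaining-antitone (≤′-step j≤′j′) = remaining-antitone j≤′j′ ∘ p─q⊆p _ _

  removal : ∀ u → ∃ λ j → j < n × u ∈ remaining j × u ∉ remaining (suc j)
  removal u = crossing (λ j → u ∈? remaining j) n ∈⊤ (∉-remaining-n u)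

  removedAt : Fin n → ℕ
  removedAt u = proj₁ (removal u)

  removedAt<n : ∀ u → removedAt u < n
  removedAt<n u = proj₁ (proj₂ (removal u))

  ∉-remaining-suc-removedAt : ∀ u → u ∉ remaining (suc (removedAt u))
  ∉-remaining-suc-removedAt u = proj₂ (proj₂ (proj₂ (removal u)))

  ∈-remaining⁺ : ∀ {u j} → j ≤ removedAt u → u ∈ remaining j
  ∈-remaining⁺ {u} j≤ = remaining-antitone (≤⇒≤′ j≤) (proj₁ (proj₂ (proj₂ (removal u))))

  ∈-remaining⁻ : ∀ {u j} → u ∈ remaining j → j ≤ removedAt u
  ∈-remaining⁻ {u} u∈ = ≮⇒≥ (λ t<j → ∉-remaining-suc-removedAt u (remaining-antitone (≤⇒≤′ t<j) u∈))

  pick-removedAt : ∀ u → pick (remaining (removedAt u)) ≡ u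
  pick-removedAt u with u ≟ᶠ pick (remaining (removedAt u))
  ... | yes u≡pick = sym u≡pick
  ... | no u≢pick = ⊥-elim (∉-remaining-suc-removedAt u (x∈p∧x≢y⇒x∈p-y (∈-remaining⁺ ≤-refl) u≢pick))

  removedAt-pick : ∀ j → j < n → removedAt (pick (remaining j)) ≡ j
  removedAt-pick j j<n = ≤-antisym (s≤s⁻¹ (≰⇒> ¬1+j≤)) (∈-remaining⁻ (pick∈ j j<n))
    where
    ¬1+j≤ : ¬ suc j ≤ removedAt (pick (remaining j))
    ¬1+j≤ 1+j≤ = x∈p─q⇒x∉q (remaining j) _ (∈-remaining⁺ 1+j≤) (x∈⁅x⁆ _)

  removalOrder : Permutation′ n
  removalOrder = permutation (λ j → pick (remaining (toℕ j))) (λ u → fromℕ< (removedAt<n u))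
    (λ u → trans (cong (pick ∘ remaining) (toℕ-fromℕ< (removedAt<n u))) (pick-removedAt u))
    (λ j → toℕ-injective (trans (toℕ-fromℕ< _) (removedAt-pick (toℕ j) (toℕ<n j))))

  ordering : Permutation′ n
  ordering = Perm.reverse ∘ₚ removalOrder

  prefixSet-ordering : ∀ m → prefixSet ordering m ≡ remaining (n ∸ m)
  prefixSet-ordering m = ⊆-antisym
    (λ {u} u∈ → ∈-remaining⁺ (∸-suc<⇒∸≤ (removedAt<n u) (subst (_< m) (position u) (∈-prefixSet⁻ ordering u∈))))
    (λ {u} u∈ → ∈-prefixSet⁺ ordering (subst (_< m) (sym (position u)) (∸≤⇒∸-suc< (removedAt<n u) (∈-remaining⁻ u∈))))
    where
    position : ∀ u → toℕ (ordering ⟨$⟩ˡ u) ≡ n ∸ suc (removedAt u)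
    position u = trans (opposite-prop _) (cong (λ t → n ∸ suc t) (toℕ-fromℕ< (removedAt<n u)))

  ordering-spec : ∀ i → P (prefixSet ordering (suc (toℕ i))) (ordering ⟨$⟩ʳ i)
  ordering-spec i = subst (λ W → P W (ordering ⟨$⟩ʳ i)) (sym prefix≡)
    (proj₂ (pick-spec _ (remaining-nonempty _ (toℕ<n (opposite i)))))
    where
    prefix≡ : prefixSet ordering (suc (toℕ i)) ≡ remaining (toℕ (opposite i))
    prefix≡ = trans (prefixSet-ordering (suc (toℕ i))) (cong remaining (sym (opposite-prop i)))

greedyOrdering : ∀ {n} (P : Subset n → Fin n → Set) → (∀ W → Nonempty W → ∃ λ v → v ∈ W × P W v) →
  Σ (Permutation′ n) λ π → ∀ i → P (prefixSet π (suc (toℕ i))) (π ⟨$⟩ʳ i)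
greedyOrdering {zero} P choose = Perm.id , λ ()
greedyOrdering {suc n} P choose = ordering , ordering-spec
  where open GreedyOrdering P choose zero

proposition6p3 : (k n : ℕ) → 2 ≤ k → (H : Hypergraph n) → IsUniform k H →
    (D : ℕ) → IsMaxSkeletalDegeneracy k H D →
    Σ (Permutation′ n) (λ π → (i : Fin n) → backCount H π i ≤ k * k * D)
proposition6p3 k@(suc (suc r)) n (s≤s (s≤s z≤n)) H uniform D dₘₐₓ =
  π , λ i → ≤-trans (traceCount-mono H _ (π ⟨$⟩ʳ i) (prefixSet-step π i)) (good i)
  where
  greedy : Σ (Permutation′ n) λ π → ∀ i → let W = prefixSet π (suc (toℕ i)); v = π ⟨$⟩ʳ i in
           traceCount H (W - v) W v ≤ k * k * D
  greedy = greedyOrdering _ (lowTraceCountVertex (suc r) uniform (maxSkeletalDegeneracy⇒degenerate dₘₐₓ) z<s)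
  open Σ greedy renaming (proj₁ to π; proj₂ to good)
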